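{- Let $G$ be a graph on $n$ nodes, let $k \in \left\{\left\lfloor \frac{n-1}{2}\right\rfloor, \left\lfloor \frac{n-1}{2}\right\rfloor+1, \ldots, n-2\right\}$ be an integer, and let $\mathcal{L}$ be a left partial layout of $G$ with respect to bandwidth $k$. For each $0 \le j < n-k-1$ define \[A_j := \{v \in V(G) \setminus \operatorname{im}(\mathcal{L}) : \{\mathcal{L}(i), v\} \notin E(G) \text{ for all } 0 \le i \le j\}.\] Then there exists a right partial layout $\mathcal{R}$ of $G$ with respect to bandwidth $k$, compatible with $\mathcal{L}$, such that $(\mathcal{L}, \mathcal{R})$ is feasible with respect to bandwidth $k$ if and only if $|A_j| \ge n-k-j-1$ for all $0 \le j < n-k-1$.
   Context: Graphs are unweighted, undirected, finite, with no self-loops. A layout of a graph $G$ on $n$ nodes is a bijection $\pi : V(G) \to \{0,1,\ldots,n-1\}$; the layout bandwidth $\beta_\pi(G)$ is the minimum non-negative integer $k$ such that $|\pi(u)-\pi(v)| \le k$ for every edge $\{u,v\}$. For $\left\lfloor \frac{n-1}{2}\right\rfloor \le k \le n-2$: a left partial layout (w.r.t. bandwidth $k$) is an injective map $\mathcal{L} : \{0,1,\ldots,n-k-2\} \to V(G)$; a right partial layout (w.r.t. bandwidth $k$) is an injective map $\mathcal{R} : \{k+1,k+2,\ldots,n-1\} \to V(G)$. $\mathcal{L}$ and $\mathcal{R}$ are compatible if $\operatorname{im}(\mathcal{L}) \cap \operatorname{im}(\mathcal{R}) = \emptyset$, equivalently if there is a layout $\pi$ such that $\pi^{ -1}$ agrees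 with $\mathcal{L}$ and with $\mathcal{R}$ on their domains (such $\pi$ is said to induce $\mathcal{L}$ and $\mathcal{R}$). A compatible pair $(\mathcal{L}, \mathcal{R})$ is feasible (w.r.t. bandwidth $k$) if $\beta_\pi(G) \le k$ for every layout $\pi$ inducing $\mathcal{L}$ and $\mathcal{R}$. -}

module Defs where

open import Data.Nat using (ℕ; zero; suc; _+_; _∸_; _≤_; _<_; _/_)
open import Data.Fin using (Fin; toℕ)
open import Data.Fin.Properties using (any?; all?)
open import Data.Bool using (Bool; true; false)
open import Data.List using (List; length; filter)
open import Data.List.Base using (allFin)
open import Data.Product using (Σ; ∃; _×_; _,_)
open import Relation.Nullary using (¬_; Dec; yes; no)
open import Relation.Nullary.Decidable using (¬?; _×-dec_)
open import Relation.Binary.PropositionalEquality using (_≡_; _≢_)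
open import Function.Bundles using (_↔_; Inverse)
open import Function.Definitions using (Injective)

record Graph (n : ℕ) : Set where
  field
    adj       : Fin n → Fin n → Bool
    adj-sym   : ∀ u v → adj u v ≡ adj v u
    adj-irrefl : ∀ v → adj v v ≡ false

open Graph public

Edge : ∀ {n} → Graph n → Fin n → Fin n → Set
Edge G u v = adj G u v ≡ true

-- A layout: a bijection V(G) → {0,…,n-1}.
Layout : ℕ → Set
Layout n = Fin n ↔ Fin n

BandwidthAtMost : ∀ {n} → Graph n → Layout n → ℕ → Set
BandwidthAtMost {n} G π k =
  ∀ u v → Edge G u v →
    (toℕ (Inverse.to π u) ≤ toℕ (Inverse.to π v) + k) ×
    (toℕ (Inverse.to π v) ≤ toℕ (Inverse.to π u) + k)

LeftPartial : ℕ → ℕ → Set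
LeftPartial n k = Σ (Fin (n ∸ (k + 1)) → Fin n) Injective′
  where Injective′ = λ f → Injective _≡_ _≡_ f

-- Right partial layout w.r.t. bandwidth k: injective map
-- {k+1,…,n-1} → V(G); index i : Fin (n ∸ (k + 1)) stands for position k+1+i.
RightPartial : ℕ → ℕ → Set
RightPartial n k = Σ (Fin (n ∸ (k + 1)) → Fin n) (λ f → Injective _≡_ _≡_ f)

module _ {n k : ℕ} where
  lmap : LeftPartial n k → Fin (n ∸ (k + 1)) → Fin n
  lmap (f , _) = f

  rmap : RightPartial n k → Fin (n ∸ (k + 1)) → Fin n
  rmap (f , _) = f

  Compatible : LeftPartial n k → RightPartial n k → Set
  Compatible L R = ∀ i j → lmap L i ≢ rmap R j

  Induces : Layout n → LeftPartial n k → RightPartial n k → Set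
  Induces π L R =
    (∀ i → toℕ (Inverse.to π (lmap L i)) ≡ toℕ i) ×
    (∀ i → toℕ (Inverse.to π (rmap R i)) ≡ k + 1 + toℕ i)

  Feasible : Graph n → LeftPartial n k → RightPartial n k → Set
  Feasible G L R =
    Compatible L R × (∀ (π : Layout n) → Induces π L R → BandwidthAtMost G π k)

  InA : Graph n → LeftPartial n k → ℕ → Fin n → Set
  InA G L j v =
    (¬ ∃ λ i → lmap L i ≡ v) ×
    (∀ i → toℕ i ≤ j → adj G (lmap L i) v ≡ false)

  card-A : Graph n → LeftPartial n k → ℕ → ℕ
  card-A G L j = length (filter inA? (allFin n))
    where
      open import Data.Fin.Properties using (_≟_)
      open import Data.Nat.Properties using (_≤?_)
      open import Data.Bool.Properties renaming (_≟_ to _≟ᵇ_)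
      inA? : ∀ v → Dec (InA G L j v)
      inA? v = ¬? (any? (λ i → lmap L i ≟ v))
               ×-dec all? (λ i → Data.Nat.Properties._≤?_ (toℕ i) j
                                 Relation.Nullary.Decidable.→-dec
                                 (adj G (lmap L i) v ≟ᵇ false))
        where import Data.Nat.Properties
              import Relation.Nullary.Decidable

-- Write m = n - k - 1 for the number of left slots 0 … m-1 and of right slots
-- k+1 … k+m.  Since k ≥ ⌊(n-1)/2⌋ these slots do not overlap, and an edge of
-- stretch > k can only join a left slot i to a right slot k+1+s with i ≤ s.  Hence
-- (L, R) is feasible iff R(s) ∈ A_s for every s.  If so, R(j), …, R(m-1) are
-- m - j distinct elements of A_j.  Conversely, if |A_j| ≥ m - j for all j, choose
-- R(m-1), R(m-2), …, R(0) greedily: when R(j) is chosen only m - j - 1 nodes are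
-- taken, so some node of A_j is still free.

module Submission where

open import Defs
open import Data.Nat using (ℕ; zero; suc; _+_; _*_; _∸_; _≤_; _<_; _/_; _%_; s≤s; z<s)
open import Data.Nat.Properties
  using (≤-trans; ≤-<-trans; ≤-reflexive; <⇒≱; <⇒≢; _<?_; ≮⇒≥; m≤m+n; m≤n+m∸n; m<1+n⇒m≤n;
         +-comm; +-suc; +-monoʳ-≤; +-mono-≤; +-monoˡ-≤; *-monoˡ-≤; +-cancelˡ-≡;
         ∸-monoˡ-<; ∸-+-assoc; m∸n≤m; m+[n∸m]≡n; m≤n+o⇒m∸n≤o; m+n≤o⇒m≤o∸n; m+n≤o⇒n≤o;
         module ≤-Reasoning)
open import Data.Nat.DivMod using (m≡m%n+[m/n]*n; m%n<n)
open import Data.Nat.Tactic.RingSolver using (solve-∀)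
open import Data.Fin using (Fin; zero; suc; toℕ; fromℕ<; inject≤)
open import Data.Fin.Properties
  using (_≟_; toℕ-injective; toℕ-fromℕ<; toℕ<n; toℕ-inject≤; inject≤-injective; injective⇒≤;
         suc-injective; 0≢1+n; any?; all?)
open import Data.Fin.Permutation using (Permutation′; _⟨$⟩ʳ_; _∘ₚ_; transpose)
import Data.Fin.Permutation as Permutation
import Data.Fin.Permutation.Components as PC
open import Data.Bool using (false)
open import Data.Bool.Properties using (¬-not)
open import Data.List using (List; length; filter; lookup)
open import Data.List.Base using (allFin)
import Data.List.Relation.Unary.All as All
open import Data.List.Relation.Unary.AllPairs using (_∷_)
open import Data.List.Relation.Unary.Unique.Propositional using (Unique)
open import Data.List.Relation.Unary.Unique.Propositional.Properties using (allFin⁺; filter⁺)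
open import Data.List.Membership.Propositional using (_∈_)
open import Data.List.Membership.Propositional.Properties using (∈-filter⁺; ∈-filter⁻; ∈-allFin; ∈-lookup)
open import Data.List.Membership.Setoid.Properties using (index-injective)
open import Data.Product using (Σ; ∃; _×_; _,_; proj₁; proj₂)
open import Relation.Nullary using (yes; no; contradiction)
open import Relation.Nullary.Decidable using (¬?; _×-dec_; dec-true; dec-false)
open import Relation.Unary using (Pred; Decidable)
open import Relation.Binary.PropositionalEquality
  using (_≡_; _≢_; refl; sym; trans; cong; subst; subst₂; setoid)
open import Function using (_∘_)
open import Function.Bundles using (Injection; _⇔_; mk⇔)
open import Function.Definitions using (Injective)
open import Function.Properties.Inverse using (↔⇒↣)
open import Level using (0ℓ)

suc[m+n]≡n+1+m : ∀ m n → suc (m + n) ≡ n + 1 + m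
suc[m+n]≡n+1+m = solve-∀

2+m*2≡[m+1]+[m+1] : ∀ m → 2 + m * 2 ≡ (m + 1) + (m + 1)
2+m*2≡[m+1]+[m+1] = solve-∀

m+n+1≡m+1+n : ∀ m n → m + n + 1 ≡ m + 1 + n
m+n+1≡m+1+n = solve-∀

[n∸1]/2≤k⇒n∸[k+1]≤k+1 : ∀ n k → (n ∸ 1) / 2 ≤ k → n ∸ (k + 1) ≤ k + 1
[n∸1]/2≤k⇒n∸[k+1]≤k+1 n k half≤k = m≤n+o⇒m∸n≤o n (k + 1) (begin
  n                                   ≤⟨ m≤n+m∸n n 1 ⟩
  1 + (n ∸ 1)                         ≡⟨ cong (1 +_) (m≡m%n+[m/n]*n (n ∸ 1) 2) ⟩
  1 + ((n ∸ 1) % 2 + (n ∸ 1) / 2 * 2) ≤⟨ +-monoʳ-≤ 1 (+-mono-≤ (m<1+n⇒m≤n (m%n<n (n ∸ 1) 2))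
                                                                (*-monoˡ-≤ 2 half≤k)) ⟩
  2 + k * 2                           ≡⟨ 2+m*2≡[m+1]+[m+1] k ⟩
  (k + 1) + (k + 1)                   ∎)
  where open ≤-Reasoning

n∸[k+j+1]≡n∸[k+1]∸j : ∀ n k j → n ∸ (k + j + 1) ≡ n ∸ (k + 1) ∸ j
n∸[k+j+1]≡n∸[k+1]∸j n k j = trans (cong (n ∸_) (m+n+1≡m+1+n k j)) (sym (∸-+-assoc n (k + 1) j))

m<o∸n⇒n+m<o : ∀ {m} n {o} → m < o ∸ n → n + m < o
m<o∸n⇒n+m<o zero lt = lt
m<o∸n⇒n+m<o (suc n) {suc o} lt = s≤s (m<o∸n⇒n+m<o n lt)

raise∸ : ∀ a {o} → Fin (o ∸ a) → Fin o
raise∸ a i = fromℕ< (m<o∸n⇒n+m<o a (toℕ<n i))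

toℕ-raise∸ : ∀ a {o} (i : Fin (o ∸ a)) → toℕ (raise∸ a i) ≡ a + toℕ i
toℕ-raise∸ a i = toℕ-fromℕ< _

raise∸-injective : ∀ a {o} → Injective _≡_ _≡_ (raise∸ a {o})
raise∸-injective a {o} {i} {j} eq = toℕ-injective (+-cancelˡ-≡ a (toℕ i) (toℕ j)
  (trans (sym (toℕ-raise∸ a i)) (trans (cong toℕ eq) (toℕ-raise∸ a j))))

⟨$⟩ʳ-injective : ∀ {n} (π : Permutation′ n) → Injective _≡_ _≡_ (π ⟨$⟩ʳ_)
⟨$⟩ʳ-injective π = Injection.injective (↔⇒↣ π)

transpose-matchˡ : ∀ {n} (i j : Fin n) → PC.transpose i j i ≡ j
transpose-matchˡ i j rewrite dec-true (i ≟ i) refl = refl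

transpose-fixes : ∀ {n} {i j x : Fin n} → x ≢ i → x ≢ j → PC.transpose i j x ≡ x
transpose-fixes {i = i} {j} {x} x≢i x≢j rewrite dec-false (x ≟ i) x≢i | dec-false (x ≟ j) x≢j = refl

extend-permutation : ∀ {a n} (π₀ : Permutation′ n) (v p : Fin a → Fin n) →
  Injective _≡_ _≡_ v → Injective _≡_ _≡_ p →
  Σ (Permutation′ n) λ π → (∀ t → π ⟨$⟩ʳ v t ≡ p t) ×
    (∀ x → (∀ t → v t ≢ x) → (∀ t → p t ≢ π₀ ⟨$⟩ʳ x) → π ⟨$⟩ʳ x ≡ π₀ ⟨$⟩ʳ x)
extend-permutation {zero} π₀ v p _ _ = π₀ , (λ ()) , λ _ _ _ → refl
extend-permutation {suc a} π₀ v p v-inj p-inj = π ∘ₚ transpose x₀ (p zero) , maps , keeps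
  where
    ih = extend-permutation π₀ (v ∘ suc) (p ∘ suc) (suc-injective ∘ v-inj) (suc-injective ∘ p-inj)
    π = proj₁ ih
    π-maps = proj₁ (proj₂ ih)
    π-keeps = proj₂ (proj₂ ih)
    x₀ = π ⟨$⟩ʳ v zero

    maps : ∀ t → PC.transpose x₀ (p zero) (π ⟨$⟩ʳ v t) ≡ p t
    maps zero = transpose-matchˡ x₀ (p zero)
    maps (suc t) = trans (cong (PC.transpose x₀ (p zero)) (π-maps t)) (transpose-fixes
      (λ eq → 0≢1+n (sym (v-inj (⟨$⟩ʳ-injective π (trans (π-maps t) eq)))))
      (λ eq → 0≢1+n (sym (p-inj eq))))

    keeps : ∀ x → (∀ t → v t ≢ x) → (∀ t → p t ≢ π₀ ⟨$⟩ʳ x) →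
            PC.transpose x₀ (p zero) (π ⟨$⟩ʳ x) ≡ π₀ ⟨$⟩ʳ x
    keeps x v≢x p≢π₀x = trans (cong (PC.transpose x₀ (p zero)) kept) (transpose-fixes
      (λ eq → v≢x zero (sym (⟨$⟩ʳ-injective π (trans kept eq))))
      (λ eq → p≢π₀x zero (sym eq)))
      where kept = π-keeps x (v≢x ∘ suc) (p≢π₀x ∘ suc)

module _ {A : Set} where

  injective⇒≤length : ∀ {p} {xs : List A} (f : Fin p → A) → Injective _≡_ _≡_ f →
                      (∀ t → f t ∈ xs) → p ≤ length xs
  injective⇒≤length f f-inj f∈xs =
    injective⇒≤ (λ {s} {t} eq → f-inj (index-injective (setoid A) (f∈xs s) (f∈xs t) eq))

  unique⇒lookup-injective : ∀ {xs : List A} → Unique xs → Injective _≡_ _≡_ (lookup xs)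
  unique⇒lookup-injective (_ ∷ _) {zero} {zero} _ = refl
  unique⇒lookup-injective (x∉xs ∷ _) {zero} {suc j} eq = contradiction eq (All.lookup x∉xs (∈-lookup j))
  unique⇒lookup-injective (x∉xs ∷ _) {suc i} {zero} eq = contradiction (sym eq) (All.lookup x∉xs (∈-lookup i))
  unique⇒lookup-injective (_ ∷ u) {suc i} {suc j} eq = cong suc (unique⇒lookup-injective u eq)

  unique-covered⇒length≤ : ∀ {q} {xs : List A} → Unique xs → (g : Fin q → A) →
                           (∀ t → ∃ λ i → g i ≡ lookup xs t) → length xs ≤ q
  unique-covered⇒length≤ u g covered = injective⇒≤ λ {s} {t} eq →
    unique⇒lookup-injective u (trans (sym (proj₂ (covered s))) (trans (cong g eq) (proj₂ (covered t))))

module _ {n : ℕ} {P : Pred (Fin n) 0ℓ} (P? : Decidable P) where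

  count : ℕ
  count = length (filter P? (allFin n))

  injective⇒≤count : ∀ {p} (f : Fin p → Fin n) → Injective _≡_ _≡_ f → (∀ t → P (f t)) → p ≤ count
  injective⇒≤count f f-inj f∈P = injective⇒≤length f f-inj λ t → ∈-filter⁺ P? (∈-allFin (f t)) (f∈P t)

  ∃-outside-image : ∀ {q} (g : Fin q → Fin n) → q < count → ∃ λ x → P x × (∀ i → g i ≢ x)
  ∃-outside-image g q<count with any? (λ x → P? x ×-dec all? (λ i → ¬? (g i ≟ x)))
  ... | yes found = found
  ... | no none = contradiction (unique-covered⇒length≤ (filter⁺ P? (allFin⁺ n)) g covered) (<⇒≱ q<count)
    where
      covered : ∀ t → ∃ λ i → g i ≡ lookup (filter P? (allFin n)) t
      covered t with any? (λ i → g i ≟ lookup (filter P? (allFin n)) t)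
      ... | yes hit = hit
      ... | no miss = contradiction
        (_ , proj₂ (∈-filter⁻ P? {xs = allFin n} (∈-lookup t)) , λ i eq → miss (i , eq)) none

distinct-representatives : ∀ {n} m (P : ℕ → Pred (Fin n) 0ℓ) (P? : ∀ j → Decidable (P j)) →
  (∀ j → j < m → m ∸ j ≤ count (P? j)) →
  Σ (Fin m → Fin n) λ f → Injective _≡_ _≡_ f × (∀ s → P (toℕ s) (f s))
distinct-representatives zero P P? _ = (λ ()) , (λ { {()} }) , (λ ())
distinct-representatives (suc m) P P? large = f , f-inj , f∈P
  where
    rest = distinct-representatives m (P ∘ suc) (P? ∘ suc) (λ j j<m → large (suc j) (s≤s j<m))
    g = proj₁ rest
    new = ∃-outside-image (P? 0) g (large 0 z<s)

    f : Fin (suc m) → Fin _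
    f zero = proj₁ new
    f (suc s) = g s

    f-inj : Injective _≡_ _≡_ f
    f-inj {zero} {zero} _ = refl
    f-inj {zero} {suc t} eq = contradiction (sym eq) (proj₂ (proj₂ new) t)
    f-inj {suc s} {zero} eq = contradiction eq (proj₂ (proj₂ new) s)
    f-inj {suc s} {suc t} eq = cong suc (proj₁ (proj₂ rest) eq)

    f∈P : ∀ s → P (toℕ s) (f s)
    f∈P zero = proj₁ (proj₂ new)
    f∈P (suc s) = proj₂ (proj₂ rest) s

module _ (n k : ℕ) where

  private
    m : ℕ
    m = n ∸ (k + 1)

  leftSlot : Fin m → Fin n
  leftSlot i = inject≤ i (m∸n≤m n (k + 1))

  rightSlot : Fin m → Fin n
  rightSlot = raise∸ (k + 1)

  toℕ-leftSlot : ∀ i → toℕ (leftSlot i) ≡ toℕ i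
  toℕ-leftSlot i = toℕ-inject≤ i _

  toℕ-rightSlot : ∀ i → toℕ (rightSlot i) ≡ k + 1 + toℕ i
  toℕ-rightSlot = toℕ-raise∸ (k + 1)

  leftSlot-injective : Injective _≡_ _≡_ leftSlot
  leftSlot-injective = inject≤-injective _ _ _ _

  slots-disjoint : m ≤ k + 1 → ∀ i j → leftSlot i ≢ rightSlot j
  slots-disjoint m≤k+1 i j eq = <⇒≢ left<right (cong toℕ eq)
    where
      open ≤-Reasoning
      left<right : toℕ (leftSlot i) < toℕ (rightSlot j)
      left<right = begin-strict
        toℕ (leftSlot i)  ≡⟨ toℕ-leftSlot i ⟩
        toℕ i             <⟨ toℕ<n i ⟩
        m                 ≤⟨ m≤k+1 ⟩
        k + 1             ≤⟨ m≤m+n (k + 1) (toℕ j) ⟩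
        k + 1 + toℕ j     ≡⟨ toℕ-rightSlot j ⟨
        toℕ (rightSlot j) ∎

  module _ (G : Graph n) (L : LeftPartial n k) where

    inducing-layout : m ≤ k + 1 → (R : RightPartial n k) → Compatible {n} {k} L R →
                      Σ (Layout n) λ π → Induces {n} {k} π L R
    inducing-layout m≤k+1 (r , r-inj) compatible =
      π , (λ i → trans (cong toℕ (π-maps i)) (toℕ-leftSlot i))
        , (λ i → trans (cong toℕ (π-keeps i)) (toℕ-rightSlot i))
      where
        right = extend-permutation Permutation.id r rightSlot r-inj (raise∸-injective (k + 1))
        left = extend-permutation (proj₁ right) (lmap {n} {k} L) leftSlot (proj₂ L) leftSlot-injective
        π = proj₁ left
        π-maps = proj₁ (proj₂ left)
        π-keeps : ∀ i → π ⟨$⟩ʳ r i ≡ rightSlot i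
        π-keeps i = trans
          (proj₂ (proj₂ left) (r i) (λ t → compatible t i)
                 (λ t eq → slots-disjoint m≤k+1 t i (trans eq (proj₁ (proj₂ right) i))))
          (proj₁ (proj₂ right) i)

    feasible⇒later-slots∈A : (R : RightPartial n k) → Feasible {n} {k} G L R →
      (π : Layout n) → Induces {n} {k} π L R →
      ∀ {j} s → j ≤ toℕ s → InA {n} {k} G L j (rmap {n} {k} R s)
    feasible⇒later-slots∈A R (compatible , bounded) π induces@(atL , atR) {j} s j≤s =
      (λ (i , eq) → compatible i s eq) ,
      λ i i≤j → ¬-not λ edge → <⇒≱ (too-far i i≤j) (proj₂ (bounded π induces _ _ edge))
      where
        open ≤-Reasoning
        too-far : ∀ i → toℕ i ≤ j →
                  toℕ (π ⟨$⟩ʳ lmap {n} {k} L i) + k < toℕ (π ⟨$⟩ʳ rmap {n} {k} R s)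
        too-far i i≤j = begin-strict
          toℕ (π ⟨$⟩ʳ lmap {n} {k} L i) + k ≡⟨ cong (_+ k) (atL i) ⟩
          toℕ i + k                          ≤⟨ +-monoˡ-≤ k (≤-trans i≤j j≤s) ⟩
          toℕ s + k                          <⟨ ≤-reflexive (suc[m+n]≡n+1+m (toℕ s) k) ⟩
          k + 1 + toℕ s                      ≡⟨ atR s ⟨
          toℕ (π ⟨$⟩ʳ rmap {n} {k} R s)      ∎

    feasible⇒bounds : m ≤ k + 1 → Σ (RightPartial n k) (Feasible {n} {k} G L) →
                     ∀ j → m ∸ j ≤ card-A {n} {k} G L j
    feasible⇒bounds m≤k+1 (R@(r , r-inj) , feasible) j =
      injective⇒≤count _ (r ∘ raise∸ j) (raise∸-injective j ∘ r-inj) λ t →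
        feasible⇒later-slots∈A R feasible π induces (raise∸ j t)
          (≤-trans (m≤m+n j (toℕ t)) (≤-reflexive (sym (toℕ-raise∸ j t))))
      where
        π-induces = inducing-layout m≤k+1 R (proj₁ feasible)
        π = proj₁ π-induces
        induces = proj₂ π-induces

    module _ (R : RightPartial n k) (R∈A : ∀ s → InA {n} {k} G L (toℕ s) (rmap {n} {k} R s)) where

      stretch-bound : (π : Layout n) → Induces {n} {k} π L R →
                      ∀ u v → Edge G u v → toℕ (π ⟨$⟩ʳ u) ≤ toℕ (π ⟨$⟩ʳ v) + k
      stretch-bound π (atL , atR) u v edge with toℕ (π ⟨$⟩ʳ v) + k <? toℕ (π ⟨$⟩ʳ u)
      ... | no close = ≮⇒≥ close
      ... | yes far = contradiction (trans (sym edge) (trans (adj-sym G u v) v≁u)) λ ()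
        where
          p = toℕ (π ⟨$⟩ʳ v)
          q = toℕ (π ⟨$⟩ʳ u)
          p+[k+1]≤q : p + (k + 1) ≤ q
          p+[k+1]≤q = subst (_≤ q) (sym (trans (cong (p +_) (+-comm k 1)) (+-suc p k))) far
          k+1≤q = m+n≤o⇒n≤o p p+[k+1]≤q
          p≤q∸[k+1] = m+n≤o⇒m≤o∸n p p+[k+1]≤q
          q∸[k+1]<m = ∸-monoˡ-< (toℕ<n (π ⟨$⟩ʳ u)) k+1≤q
          i = fromℕ< (≤-<-trans p≤q∸[k+1] q∸[k+1]<m)
          s = fromℕ< q∸[k+1]<m
          L-at-p : lmap {n} {k} L i ≡ v
          L-at-p = ⟨$⟩ʳ-injective π (toℕ-injective (trans (atL i) (toℕ-fromℕ< _)))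
          R-at-q : rmap {n} {k} R s ≡ u
          R-at-q = ⟨$⟩ʳ-injective π (toℕ-injective
            (trans (atR s) (trans (cong (k + 1 +_) (toℕ-fromℕ< _)) (m+[n∸m]≡n k+1≤q))))
          v≁u : adj G v u ≡ false
          v≁u = subst₂ (λ x y → adj G x y ≡ false) L-at-p R-at-q
            (proj₂ (R∈A s) i (subst₂ _≤_ (sym (toℕ-fromℕ< _)) (sym (toℕ-fromℕ< _)) p≤q∸[k+1]))

      representatives⇒feasible : Feasible {n} {k} G L R
      representatives⇒feasible =
        (λ i s eq → proj₁ (R∈A s) (i , eq)) ,
        λ π induces u v edge → stretch-bound π induces u v edge ,
                               stretch-bound π induces v u (trans (adj-sym G v u) edge)

    bounds⇒feasible : (∀ j → j < m → m ∸ j ≤ card-A {n} {k} G L j) →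
                     Σ (RightPartial n k) (Feasible {n} {k} G L)
    -- card-A G L j unfolds to the count of the (unnamed) decision procedure for
    -- InA G L j, so unification supplies it.
    bounds⇒feasible bounds with distinct-representatives m (InA {n} {k} G L) _ bounds
    ... | r , r-inj , r∈A = (r , r-inj) , representatives⇒feasible (r , r-inj) r∈A

theorem3p2 : (n : ℕ) (G : Graph n) (k : ℕ) → 2 ≤ n →
    (n ∸ 1) / 2 ≤ k → k ≤ n ∸ 2 →
    (L : LeftPartial n k) →
    (Σ (RightPartial n k) (λ R → Feasible {n} {k} G L R))
      ⇔ (∀ (j : ℕ) → j < n ∸ (k + 1) → n ∸ (k + j + 1) ≤ card-A {n} {k} G L j)
theorem3p2 n G k _ half≤k _ L = mk⇔
  (λ feasible j _ → subst (_≤ card-A {n} {k} G L j) (sym (n∸[k+j+1]≡n∸[k+1]∸j n k j))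
    (feasible⇒bounds n k G L ([n∸1]/2≤k⇒n∸[k+1]≤k+1 n k half≤k) feasible j))
  (λ bounds → bounds⇒feasible n k G L λ j j<m →
    subst (_≤ card-A {n} {k} G L j) (n∸[k+j+1]≡n∸[k+1]∸j n k j) (bounds j j<m))
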